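{- Let $n\ge 1$. Call a pair $(s_{NW},s_{SW})$, where $s_{NW}$ is a sequence of length $n$ and $s_{SW}$ a sequence of length $n-1$ with entries in $\{\text{arrow},\text{blank}\}$, a \emph{checkmark pair} if the number of arrows in $s_{NW}$ equals, or exceeds by exactly one, the number of arrows in $s_{SW}$. Call a checkmark pair a \emph{Dyck checkmark pair} if, in addition, writing $k$ for the number of arrows in $s_{NW}$, for every $h=1,\dots,k$ the index (counted from $1$ to $n$) of the $h$-th arrow of $s_{NW}$ is strictly greater than the index (counted from $1$ to $n-1$) of the $h$-th arrow of $s_{SW}$. For $p\in\mathcal{B}_{2n}$ define its checkmark representation $(s_{NW}(p),s_{SW}(p))$ as follows: for $h=1,\dots,n$, the $h$-th entry of $s_{NW}(p)$ is an arrow iff $p$ has a right turn at a vertex $v_i=(i,y_i)$ with $i+y_i=2(h-1)$; for $j=1,\dots,n-1$, the $j$-th entry of $s_{SW}(p)$ is an arrow iff $p$ has a left turn at a vertex $v_i=(i,y_i)$ with $i-y_i=2j$. Then $p\mapsto (s_{NW}(p),s_{SW}(p))$ is a bijection from $\mathcal{B}_{2n}$ onto the set of checkmark pairs (of lengths $n$ and $n-1$), and it restricts to a bijection from $\mathcal{D}_{2n}$ onto the set of Dyck checkmark pairs.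
   Context: A path of length $t$ is a sequence of vertices $v_0,\dots,v_t$ in $\mathbb{Z}^2$ with $v_0=(0,0)$, $v_t=(t,0)$ and each step $v_j-v_{j-1}\in\{(1,1),(1,-1)\}$ (an up-step or down-step respectively). $\mathcal{B}_{2n}$ (bilateral Dyck paths) is the set of all such paths of length $2n$ with vertices in $\mathbb{Z}_{\ge0}\times\mathbb{Z}$; $\mathcal{D}_{2n}$ (Dyck paths) is the subset of those with all vertices in $\mathbb{Z}_{\ge0}\times\mathbb{Z}_{\ge0}$. Imagining the path as entering $v_0$ by an up-step, a \emph{right turn} of $p$ is a vertex $v_i$ ($0\le i<2n$) at which an up-step is followed by a down-step, where $v_0$ counts as a right turn iff the first step of $p$ is a down-step; a \emph{left turn} is a vertex $v_i$ ($0<i<2n$) at which a down-step is followed by an up-step. -}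

module Defs where

open import Data.Bool using (Bool; true; false; _∧_)
open import Data.Nat as ℕ using (ℕ; zero; suc; _*_; _∸_; _<_; _≤_)
open import Data.Integer as ℤ using (ℤ; +_; -[1+_])
open import Data.List using (List; []; _∷_; length; upTo)
open import Data.Bool.ListAction using (any)
open import Data.Vec using (Vec; toList; tabulate)
open import Data.Fin using (Fin; toℕ)
open import Data.Maybe using (Maybe; just; nothing)
open import Data.Sum using (_⊎_)
open import Data.Product using (Σ; ∃; _×_)
open import Relation.Nullary.Decidable using (⌊_⌋)
open import Relation.Binary.PropositionalEquality using (_≡_)

-- A path of length t is encoded by its sequence of steps:
-- true = up-step (1,1), false = down-step (1,-1).
-- Step j (0-based) goes from v_j to v_{j+1}.

stepAt : List Bool → ℕ → Maybe Bool
stepAt []       _       = nothing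
stepAt (b ∷ _)  zero    = just b
stepAt (_ ∷ bs) (suc k) = stepAt bs k

isStep : Maybe Bool → Bool → Bool
isStep (just true)  true  = true
isStep (just false) false = true
isStep _            _     = false

stepVal : Bool → ℤ
stepVal true  = + 1
stepVal false = -[1+ 0 ]

height : List Bool → ℕ → ℤ
height _        zero    = + 0
height []       (suc _) = + 0
height (b ∷ bs) (suc i) = stepVal b ℤ.+ height bs i

-- right turn at v_i (0 ≤ i < t): entering v_0 by a virtual up-step,
-- step i-1 is up and step i is down.
isRightTurn : List Bool → ℕ → Bool
isRightTurn p zero    = isStep (stepAt p 0) false
isRightTurn p (suc k) = isStep (stepAt p k) true ∧ isStep (stepAt p (suc k)) false

isLeftTurn : List Bool → ℕ → Bool
isLeftTurn p zero    = false
isLeftTurn p (suc k) = isStep (stepAt p k) false ∧ isStep (stepAt p (suc k)) true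

Path : ℕ → Set
Path n = Vec Bool (2 * n)

IsBilateral : (n : ℕ) → Path n → Set
IsBilateral n p = height (toList p) (2 * n) ≡ + 0

IsDyck : (n : ℕ) → Path n → Set
IsDyck n p = IsBilateral n p × (∀ i → i ≤ 2 * n → + 0 ℤ.≤ height (toList p) i)

-- Sequences with entries in {arrow, blank}: true = arrow, false = blank.  Entry h (0-based, i.e. the (h+1)-th entry)
-- of s_NW is an arrow iff there is a right turn v_i with i + y_i = 2h.
sNW : (n : ℕ) → Path n → Vec Bool n
sNW n p = tabulate λ (h : Fin n) →
  any (λ i → isRightTurn l i ∧ ⌊ (+ i ℤ.+ height l i) ℤ.≟ + (2 * toℕ h) ⌋) (upTo (2 * n))
  where l = toList p

-- Entry j (0-based, i.e. the (j+1)-th entry) of s_SW is an arrow iff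
-- there is a left turn v_i with i - y_i = 2(j+1).
sSW : (n : ℕ) → Path n → Vec Bool (n ∸ 1)
sSW n p = tabulate λ (j : Fin (n ∸ 1)) →
  any (λ i → isLeftTurn l i ∧ ⌊ (+ i ℤ.- height l i) ℤ.≟ + (2 * suc (toℕ j)) ⌋) (upTo (2 * n))
  where l = toList p

arrowPosFrom : ℕ → List Bool → List ℕ
arrowPosFrom k []           = []
arrowPosFrom k (true ∷ xs)  = k ∷ arrowPosFrom (suc k) xs
arrowPosFrom k (false ∷ xs) = arrowPosFrom (suc k) xs

arrowPos : ∀ {m} → Vec Bool m → List ℕ
arrowPos v = arrowPosFrom 1 (toList v)

arrows : ∀ {m} → Vec Bool m → ℕ
arrows v = length (arrowPos v)

nth : List ℕ → ℕ → Maybe ℕ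
nth []       _       = nothing
nth (x ∷ _)  zero    = just x
nth (_ ∷ xs) (suc k) = nth xs k

IsCheckmarkPair : (n : ℕ) → Vec Bool n → Vec Bool (n ∸ 1) → Set
IsCheckmarkPair n s t = (arrows s ≡ arrows t) ⊎ (arrows s ≡ suc (arrows t))

-- for every h = 1..k (here 0-based), the h-th arrow of t exists and its
-- index is strictly smaller than that of the h-th arrow of s
IsDyckCheckmarkPair : (n : ℕ) → Vec Bool n → Vec Bool (n ∸ 1) → Set
IsDyckCheckmarkPair n s t = IsCheckmarkPair n s t ×
  (∀ h a → nth (arrowPos s) h ≡ just a →
     Σ ℕ λ b → (nth (arrowPos t) h ≡ just b) × (b < a))

-- Since i + y_i and i − y_i are twice the numbers of up- and down-steps before
-- v_i, entry h of s_NW says that the step after the h-th up-step (the virtual one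
-- for h = 0) goes down, and entry j of s_SW that the step after the j-th
-- down-step goes up. Writing the path as D^k₀ U D^k₁ U ⋯ U D^kₙ, the arrows of
-- s_NW mark the nonempty runs among D^k₀, …, D^kₙ₋₁ and those of s_SW where
-- these runs end, except for a run ending with the n-th down-step; so the arrow
-- counts differ by one exactly when kₙ = 0, and the runs, hence the path, can be
-- read back off the pair. The run ends are the local minima of the path, and the
-- height at the end of the h-th nonempty run is nonnegative exactly when the h-th
-- arrow of s_SW precedes the h-th arrow of s_NW.
module Submission where

open import Defs
open import Data.Bool using (Bool; true; false; _∧_; _∨_; not)
open import Data.Bool.Properties using (T-≡; ⇔→≡; ∨-zeroʳ; ∧-conicalˡ; ∧-conicalʳ)
open import Data.Nat as ℕ using (ℕ; zero; suc; _+_; _*_; _∸_; _<_; _≤_; z≤n; s≤s)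
import Data.Nat.Properties as ℕ
open import Data.Integer as ℤ using (ℤ; +_; -[1+_]; +≤+)
import Data.Integer.Properties as ℤ
open import Data.Integer.Tactic.RingSolver using (solve-∀)
open import Data.List using (List; []; _∷_; length; take; upTo; applyUpTo; replicate; _++_)
import Data.List.Properties as List
open import Data.Vec using (Vec; toList; tabulate; fromList; cast)
import Data.Vec.Properties as Vec
open import Data.Fin using (toℕ)
open import Data.List.Relation.Unary.Any.Properties using (any⁺; any⁻; applyUpTo⁺; applyUpTo⁻)
open import Data.Bool.ListAction using (any)
open import Data.Product using (Σ; ∃; _×_; _,_; proj₁; proj₂)
open import Data.Sum using (_⊎_; inj₁; inj₂)
open import Data.Empty using (⊥-elim)
open import Data.Unit using (⊤; tt)
open import Data.Maybe using (just)
open import Function using (_∘_; _⇔_; mk⇔; Equivalence)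
open import Function.Properties.Equivalence using () renaming (refl to ⇔-refl; trans to ⇔-trans; sym to ⇔-sym)
open import Data.Product.Function.NonDependent.Propositional using (_×-⇔_)
open import Relation.Nullary using (¬_)
open import Relation.Nullary.Decidable using (⌊_⌋; toWitness; fromWitness)
open import Relation.Binary.PropositionalEquality

-- Diagonal coordinates of vertices

ups downs : List Bool → ℕ
ups []          = 0
ups (true ∷ l)  = suc (ups l)
ups (false ∷ l) = ups l
downs []          = 0
downs (true ∷ l)  = downs l
downs (false ∷ l) = suc (downs l)

ups+downs≡length : ∀ l → ups l + downs l ≡ length l
ups+downs≡length []          = refl
ups+downs≡length (true ∷ l)  = cong suc (ups+downs≡length l)
ups+downs≡length (false ∷ l) = trans (ℕ.+-suc (ups l) (downs l)) (cong suc (ups+downs≡length l))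

height≡ups-downs : ∀ l i → height l i ≡ + ups (take i l) ℤ.- + downs (take i l)
height≡ups-downs l           zero    = refl
height≡ups-downs []          (suc i) = refl
height≡ups-downs (true ∷ l)  (suc i) =
  trans (cong (ℤ._+_ (+ 1)) (height≡ups-downs l i)) (up (+ ups (take i l)) (+ downs (take i l)))
  where
  up : ∀ a b → + 1 ℤ.+ (a ℤ.- b) ≡ (+ 1 ℤ.+ a) ℤ.- b
  up = solve-∀
height≡ups-downs (false ∷ l) (suc i) =
  trans (cong (ℤ._+_ -[1+ 0 ]) (height≡ups-downs l i)) (down (+ ups (take i l)) (+ downs (take i l)))
  where
  down : ∀ a b → -[1+ 0 ] ℤ.+ (a ℤ.- b) ≡ a ℤ.- (+ 1 ℤ.+ b)
  down = solve-∀

ups+downs≡i : ∀ l i → i ≤ length l → ups (take i l) + downs (take i l) ≡ i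
ups+downs≡i l i i≤len = begin
  ups (take i l) + downs (take i l) ≡⟨ ups+downs≡length (take i l) ⟩
  length (take i l)                 ≡⟨ List.length-take i l ⟩
  i ℕ.⊓ length l                    ≡⟨ ℕ.m≤n⇒m⊓n≡m i≤len ⟩
  i                                 ∎
  where open ≡-Reasoning

i+height≡2*ups : ∀ l i → i ≤ length l → + i ℤ.+ height l i ≡ + (2 * ups (take i l))
i+height≡2*ups l i i≤len = begin
  + i ℤ.+ height l i       ≡⟨ cong₂ ℤ._+_ (cong +_ (sym (ups+downs≡i l i i≤len))) (height≡ups-downs l i) ⟩
  (u ℤ.+ d) ℤ.+ (u ℤ.- d) ≡⟨ sum u d ⟩
  + 2 ℤ.* u                ≡⟨ ℤ.pos-* 2 (ups (take i l)) ⟨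
  + (2 * ups (take i l))   ∎
  where
  open ≡-Reasoning
  u d : ℤ
  u = + ups (take i l)
  d = + downs (take i l)
  sum : ∀ a b → (a ℤ.+ b) ℤ.+ (a ℤ.- b) ≡ + 2 ℤ.* a
  sum = solve-∀

i-height≡2*downs : ∀ l i → i ≤ length l → + i ℤ.- height l i ≡ + (2 * downs (take i l))
i-height≡2*downs l i i≤len = begin
  + i ℤ.- height l i       ≡⟨ cong₂ ℤ._-_ (cong +_ (sym (ups+downs≡i l i i≤len))) (height≡ups-downs l i) ⟩
  (u ℤ.+ d) ℤ.- (u ℤ.- d) ≡⟨ difference u d ⟩
  + 2 ℤ.* d                ≡⟨ ℤ.pos-* 2 (downs (take i l)) ⟨
  + (2 * downs (take i l)) ∎
  where
  open ≡-Reasoning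
  u d : ℤ
  u = + ups (take i l)
  d = + downs (take i l)
  difference : ∀ a b → (a ℤ.+ b) ℤ.- (a ℤ.- b) ≡ + 2 ℤ.* b
  difference = solve-∀

-- Turns counted by up- and down-steps

-- Prefixing an up-step realises the virtual up-step entering v₀.
isRightTurn≡after-up : ∀ l i → isRightTurn l i ≡ isRightTurn (true ∷ l) (suc i)
isRightTurn≡after-up l zero    = refl
isRightTurn≡after-up l (suc i) = refl

isLeftTurn≡after-up : ∀ l i → isLeftTurn l i ≡ isLeftTurn (true ∷ l) (suc i)
isLeftTurn≡after-up l zero    = refl
isLeftTurn≡after-up l (suc i) = refl

isStep⇒<length : ∀ w i c → isStep (stepAt w i) c ≡ true → i < length w
isStep⇒<length (_ ∷ w) zero    c e = s≤s z≤n
isStep⇒<length (_ ∷ w) (suc i) c e = s≤s (isStep⇒<length w i c e)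

-- rightTurnAtUps b w h: the path b ∷ w, whose first step b precedes w, turns
-- right at a vertex inside w that is preceded by exactly h up-steps of w.
rightTurnAtUps : Bool → List Bool → ℕ → Bool
rightTurnAtUps b []          h       = false
rightTurnAtUps b (true ∷ w)  zero    = false
rightTurnAtUps b (true ∷ w)  (suc h) = rightTurnAtUps true w h
rightTurnAtUps b (false ∷ w) zero    = b ∨ rightTurnAtUps false w zero
rightTurnAtUps b (false ∷ w) (suc h) = rightTurnAtUps false w (suc h)

leftTurnAtDowns : Bool → List Bool → ℕ → Bool
leftTurnAtDowns b []          d       = false
leftTurnAtDowns b (true ∷ w)  zero    = not b ∨ leftTurnAtDowns true w zero
leftTurnAtDowns b (true ∷ w)  (suc d) = leftTurnAtDowns true w (suc d)
leftTurnAtDowns b (false ∷ w) zero    = false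
leftTurnAtDowns b (false ∷ w) (suc d) = leftTurnAtDowns false w d

rightTurnAtUps-down : ∀ b w h → rightTurnAtUps false w h ≡ true → rightTurnAtUps b (false ∷ w) h ≡ true
rightTurnAtUps-down b w zero    e = trans (cong (b ∨_) e) (∨-zeroʳ b)
rightTurnAtUps-down b w (suc h) e = e

leftTurnAtDowns-up : ∀ b w d → leftTurnAtDowns true w d ≡ true → leftTurnAtDowns b (true ∷ w) d ≡ true
leftTurnAtDowns-up b w zero    e = trans (cong (not b ∨_) e) (∨-zeroʳ (not b))
leftTurnAtDowns-up b w (suc d) e = e

rightTurn⇒rightTurnAtUps : ∀ b w i → isRightTurn (b ∷ w) (suc i) ≡ true →
  rightTurnAtUps b w (ups (take i w)) ≡ true
rightTurn⇒rightTurnAtUps true  []          zero    ()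
rightTurn⇒rightTurnAtUps false []          zero    ()
rightTurn⇒rightTurnAtUps true  (false ∷ w) zero    e = refl
rightTurn⇒rightTurnAtUps b     (true ∷ w)  (suc i) e = rightTurn⇒rightTurnAtUps true w i e
rightTurn⇒rightTurnAtUps b     (false ∷ w) (suc i) e =
  rightTurnAtUps-down b w (ups (take i w)) (rightTurn⇒rightTurnAtUps false w i e)

rightTurnAtUps⇒rightTurn : ∀ b w h → rightTurnAtUps b w h ≡ true →
  ∃ λ i → isRightTurn (b ∷ w) (suc i) ≡ true × ups (take i w) ≡ h
rightTurnAtUps⇒rightTurn true  (false ∷ w) zero    e = zero , refl , refl
rightTurnAtUps⇒rightTurn false (false ∷ w) zero    e with rightTurnAtUps⇒rightTurn false w zero e
... | i , turn , eq = suc i , turn , eq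
rightTurnAtUps⇒rightTurn b     (true ∷ w)  (suc h) e with rightTurnAtUps⇒rightTurn true w h e
... | i , turn , eq = suc i , turn , cong suc eq
rightTurnAtUps⇒rightTurn b     (false ∷ w) (suc h) e with rightTurnAtUps⇒rightTurn false w (suc h) e
... | i , turn , eq = suc i , turn , eq

leftTurn⇒leftTurnAtDowns : ∀ b w i → isLeftTurn (b ∷ w) (suc i) ≡ true →
  leftTurnAtDowns b w (downs (take i w)) ≡ true
leftTurn⇒leftTurnAtDowns true  []          zero    ()
leftTurn⇒leftTurnAtDowns false []          zero    ()
leftTurn⇒leftTurnAtDowns false (true ∷ w)  zero    e = refl
leftTurn⇒leftTurnAtDowns b     (false ∷ w) (suc i) e = leftTurn⇒leftTurnAtDowns false w i e
leftTurn⇒leftTurnAtDowns b     (true ∷ w)  (suc i) e =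
  leftTurnAtDowns-up b w (downs (take i w)) (leftTurn⇒leftTurnAtDowns true w i e)

leftTurnAtDowns⇒leftTurn : ∀ b w d → leftTurnAtDowns b w d ≡ true →
  ∃ λ i → isLeftTurn (b ∷ w) (suc i) ≡ true × downs (take i w) ≡ d
leftTurnAtDowns⇒leftTurn false (true ∷ w)  zero    e = zero , refl , refl
leftTurnAtDowns⇒leftTurn true  (true ∷ w)  zero    e with leftTurnAtDowns⇒leftTurn true w zero e
... | i , turn , eq = suc i , turn , eq
leftTurnAtDowns⇒leftTurn b     (false ∷ w) (suc d) e with leftTurnAtDowns⇒leftTurn false w d e
... | i , turn , eq = suc i , turn , cong suc eq
leftTurnAtDowns⇒leftTurn b     (true ∷ w)  (suc d) e with leftTurnAtDowns⇒leftTurn true w (suc d) e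
... | i , turn , eq = suc i , turn , eq

any-upTo≡ : ∀ m (f : ℕ → Bool) {b} →
  (∀ i → f i ≡ true → b ≡ true) → (b ≡ true → ∃ λ i → i < m × f i ≡ true) →
  any f (upTo m) ≡ b
any-upTo≡ m f sound complete = ⇔→≡ (mk⇔ to from)
  where
  to : any f (upTo m) ≡ true → _
  to e = let i , _ , fi = applyUpTo⁻ (λ i → i) (any⁻ f (upTo m) (Equivalence.from T-≡ e))
         in sound i (Equivalence.to T-≡ fi)
  from : _ → any f (upTo m) ≡ true
  from e = let i , i<m , fi = complete e
           in Equivalence.to T-≡ (any⁺ f (applyUpTo⁺ (λ i → i) (Equivalence.from T-≡ fi) i<m))

≟-sound : ∀ {x y : ℤ} → ⌊ x ℤ.≟ y ⌋ ≡ true → x ≡ y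
≟-sound e = toWitness (Equivalence.from T-≡ e)

≟-complete : ∀ {x y : ℤ} → x ≡ y → ⌊ x ℤ.≟ y ⌋ ≡ true
≟-complete x≡y = Equivalence.to T-≡ (fromWitness x≡y)

pos-2*-injective : ∀ {m n} → + (2 * m) ≡ + (2 * n) → m ≡ n
pos-2*-injective {m} {n} e = ℕ.*-cancelˡ-≡ m n 2 (ℤ.+-injective e)

rightTurn-entry : ∀ l m h → length l ≤ m →
  any (λ i → isRightTurn l i ∧ ⌊ + i ℤ.+ height l i ℤ.≟ + (2 * h) ⌋) (upTo m) ≡ rightTurnAtUps true l h
rightTurn-entry l m h len≤m = any-upTo≡ m _ sound complete
  where
  sound : ∀ i → isRightTurn l i ∧ ⌊ + i ℤ.+ height l i ℤ.≟ + (2 * h) ⌋ ≡ true → rightTurnAtUps true l h ≡ true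
  sound i e = subst (λ k → rightTurnAtUps true l k ≡ true) ups≡h (rightTurn⇒rightTurnAtUps true l i turn)
    where
    turn : isRightTurn (true ∷ l) (suc i) ≡ true
    turn = trans (sym (isRightTurn≡after-up l i)) (∧-conicalˡ _ _ e)
    ups≡h : ups (take i l) ≡ h
    ups≡h = pos-2*-injective (trans (sym (i+height≡2*ups l i (ℕ.<⇒≤ (isStep⇒<length l i false (∧-conicalʳ _ _ turn)))))
                                (≟-sound (∧-conicalʳ (isRightTurn l i) _ e)))
  complete : rightTurnAtUps true l h ≡ true →
    ∃ λ i → i < m × isRightTurn l i ∧ ⌊ + i ℤ.+ height l i ℤ.≟ + (2 * h) ⌋ ≡ true
  complete e with rightTurnAtUps⇒rightTurn true l h e
  ... | i , turn , ups≡h = i , ℕ.≤-trans i<len len≤m ,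
    cong₂ _∧_ (trans (isRightTurn≡after-up l i) turn) (≟-complete onDiagonal)
    where
    i<len : i < length l
    i<len = isStep⇒<length l i false (∧-conicalʳ _ _ turn)
    onDiagonal : + i ℤ.+ height l i ≡ + (2 * h)
    onDiagonal = trans (i+height≡2*ups l i (ℕ.<⇒≤ i<len)) (cong (λ k → + (2 * k)) ups≡h)

leftTurn-entry : ∀ l m d → length l ≤ m →
  any (λ i → isLeftTurn l i ∧ ⌊ + i ℤ.- height l i ℤ.≟ + (2 * d) ⌋) (upTo m) ≡ leftTurnAtDowns true l d
leftTurn-entry l m d len≤m = any-upTo≡ m _ sound complete
  where
  sound : ∀ i → isLeftTurn l i ∧ ⌊ + i ℤ.- height l i ℤ.≟ + (2 * d) ⌋ ≡ true → leftTurnAtDowns true l d ≡ true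
  sound i e = subst (λ k → leftTurnAtDowns true l k ≡ true) downs≡d (leftTurn⇒leftTurnAtDowns true l i turn)
    where
    turn : isLeftTurn (true ∷ l) (suc i) ≡ true
    turn = trans (sym (isLeftTurn≡after-up l i)) (∧-conicalˡ _ _ e)
    downs≡d : downs (take i l) ≡ d
    downs≡d = pos-2*-injective (trans (sym (i-height≡2*downs l i (ℕ.<⇒≤ (isStep⇒<length l i true (∧-conicalʳ _ _ turn)))))
                                  (≟-sound (∧-conicalʳ (isLeftTurn l i) _ e)))
  complete : leftTurnAtDowns true l d ≡ true →
    ∃ λ i → i < m × isLeftTurn l i ∧ ⌊ + i ℤ.- height l i ℤ.≟ + (2 * d) ⌋ ≡ true
  complete e with leftTurnAtDowns⇒leftTurn true l d e
  ... | i , turn , downs≡d = i , ℕ.≤-trans i<len len≤m ,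
    cong₂ _∧_ (trans (isLeftTurn≡after-up l i) turn) (≟-complete onDiagonal)
    where
    i<len : i < length l
    i<len = isStep⇒<length l i true (∧-conicalʳ _ _ turn)
    onDiagonal : + i ℤ.- height l i ≡ + (2 * d)
    onDiagonal = trans (i-height≡2*downs l i (ℕ.<⇒≤ i<len)) (cong (λ k → + (2 * k)) downs≡d)

-- Down-runs and the arrow sequences of a path

-- In a path false is a down-step; in an arrow sequence it is a blank.
D^_ U^_ : ℕ → List Bool
D^ k = replicate k false
U^ j = replicate j true

D^-shift : ∀ k l → D^ k ++ false ∷ l ≡ D^ (suc k) ++ l
D^-shift zero    l = refl
D^-shift (suc k) l = cong (false ∷_) (D^-shift k l)

ups-D^++ : ∀ k l → ups (D^ k ++ l) ≡ ups l
ups-D^++ zero    l = refl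
ups-D^++ (suc k) l = ups-D^++ k l

downs-D^++ : ∀ k l → downs (D^ k ++ l) ≡ k + downs l
downs-D^++ zero    l = refl
downs-D^++ (suc k) l = cong suc (downs-D^++ k l)

ups-D^ : ∀ k → ups (D^ k) ≡ 0
ups-D^ zero    = refl
ups-D^ (suc k) = ups-D^ k

downs-D^ : ∀ k → downs (D^ k) ≡ k
downs-D^ zero    = refl
downs-D^ (suc k) = cong suc (downs-D^ k)

downs-U^ : ∀ j → downs (U^ j) ≡ 0
downs-U^ zero    = refl
downs-U^ (suc j) = downs-U^ j

U^-ups : ∀ w → downs w ≡ 0 → U^ (ups w) ≡ w
U^-ups []         _ = refl
U^-ups (true ∷ w) e = cong (true ∷_) (U^-ups w e)

D^-length : ∀ t → ups t ≡ 0 → D^ (length t) ≡ t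
D^-length []          _ = refl
D^-length (false ∷ t) e = cong (false ∷_) (D^-length t e)

data Blocks : List Bool → Set where
  downsOnly   : ∀ k → Blocks (D^ k)
  downsThenUp : ∀ k {w} → Blocks w → Blocks (D^ k ++ true ∷ w)

blocksAfter : ∀ k w → Blocks (D^ k ++ w)
blocksAfter k []          = subst Blocks (sym (List.++-identityʳ (D^ k))) (downsOnly k)
blocksAfter k (true ∷ w)  = downsThenUp k (blocksAfter 0 w)
blocksAfter k (false ∷ w) = subst Blocks (sym (D^-shift k w)) (blocksAfter (suc k) w)

blocks : ∀ W → Blocks W
blocks = blocksAfter 0

applyUpTo-cong : ∀ {A : Set} {f g : ℕ → A} m → (∀ x → f x ≡ g x) → applyUpTo f m ≡ applyUpTo g m
applyUpTo-cong zero    f≗g = refl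
applyUpTo-cong (suc m) f≗g = cong₂ _∷_ (f≗g 0) (applyUpTo-cong m (f≗g ∘ suc))

applyUpTo-+ : ∀ {A : Set} (f : ℕ → A) k m → applyUpTo f (k + m) ≡ applyUpTo f k ++ applyUpTo (λ x → f (k + x)) m
applyUpTo-+ f zero    m = refl
applyUpTo-+ f (suc k) m = cong (f 0 ∷_) (applyUpTo-+ (f ∘ suc) k m)

applyUpTo-const : ∀ {A : Set} {f : ℕ → A} {a} m → (∀ x → x < m → f x ≡ a) → applyUpTo f m ≡ replicate m a
applyUpTo-const zero    f≡a = refl
applyUpTo-const (suc m) f≡a = cong₂ _∷_ (f≡a 0 (s≤s z≤n)) (applyUpTo-const m (λ x → f≡a (suc x) ∘ s≤s))

-- For a path with n up- and n down-steps these are toList (sNW n p) and toList (sSW n p).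
nwWord swWord : List Bool → List Bool
nwWord W = applyUpTo (rightTurnAtUps true W) (ups W)
swWord W = applyUpTo (leftTurnAtDowns true W ∘ suc) (downs W ∸ 1)

rightTurnAtUps-D^-U : ∀ k w h → rightTurnAtUps false (D^ k ++ true ∷ w) (suc h) ≡ rightTurnAtUps true w h
rightTurnAtUps-D^-U zero    w h = refl
rightTurnAtUps-D^-U (suc k) w h = rightTurnAtUps-D^-U k w h

leftTurnAtDowns-D^ : ∀ b k j → leftTurnAtDowns b (D^ k) j ≡ false
leftTurnAtDowns-D^ b zero    j       = refl
leftTurnAtDowns-D^ b (suc k) zero    = refl
leftTurnAtDowns-D^ b (suc k) (suc j) = leftTurnAtDowns-D^ false k j

leftTurnAtDowns-D^-< : ∀ k r j → j < k → leftTurnAtDowns false (D^ k ++ r) j ≡ false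
leftTurnAtDowns-D^-< (suc k) r zero    _         = refl
leftTurnAtDowns-D^-< (suc k) r (suc j) (s≤s j<k) = leftTurnAtDowns-D^-< k r j j<k

leftTurnAtDowns-D^-+ : ∀ k r x → leftTurnAtDowns false (D^ k ++ r) (k + x) ≡ leftTurnAtDowns false r x
leftTurnAtDowns-D^-+ zero    r x = refl
leftTurnAtDowns-D^-+ (suc k) r x = leftTurnAtDowns-D^-+ k r x

nwWord-D^ : ∀ k → nwWord (D^ k) ≡ []
nwWord-D^ k = cong (applyUpTo _) (ups-D^ k)

swWord-D^ : ∀ k → swWord (D^ k) ≡ D^ (k ∸ 1)
swWord-D^ k = begin
  applyUpTo (leftTurnAtDowns true (D^ k) ∘ suc) (downs (D^ k) ∸ 1) ≡⟨ cong (λ m → applyUpTo (leftTurnAtDowns true (D^ k) ∘ suc) (m ∸ 1)) (downs-D^ k) ⟩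
  applyUpTo (leftTurnAtDowns true (D^ k) ∘ suc) (k ∸ 1)            ≡⟨ applyUpTo-const (k ∸ 1) (λ x _ → leftTurnAtDowns-D^ true k (suc x)) ⟩
  D^ (k ∸ 1)                                                        ∎
  where open ≡-Reasoning

nwWord-U^ : ∀ j → nwWord (U^ j) ≡ D^ j
nwWord-U^ zero    = refl
nwWord-U^ (suc j) = cong (false ∷_) (nwWord-U^ j)

nwWord-D^-U : ∀ k w → nwWord (D^ (suc k) ++ true ∷ w) ≡ true ∷ nwWord w
nwWord-D^-U k w = begin
  applyUpTo (rightTurnAtUps true W) (ups (D^ k ++ true ∷ w))  ≡⟨ cong (applyUpTo _) (ups-D^++ k (true ∷ w)) ⟩
  applyUpTo (rightTurnAtUps true W) (suc (ups w))             ≡⟨ cong (true ∷_) (applyUpTo-cong (ups w) (rightTurnAtUps-D^-U k w)) ⟩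
  true ∷ nwWord w                                             ∎
  where
  open ≡-Reasoning
  W : List Bool
  W = D^ (suc k) ++ true ∷ w

swWord-D^-U : ∀ k w → swWord (D^ (suc k) ++ true ∷ w) ≡ D^ k ++ swWord (false ∷ true ∷ w)
swWord-D^-U k w = begin
  applyUpTo f (downs (D^ k ++ true ∷ w))         ≡⟨ cong (applyUpTo f) (downs-D^++ k (true ∷ w)) ⟩
  applyUpTo f (k + downs w)                      ≡⟨ applyUpTo-+ f k (downs w) ⟩
  applyUpTo f k ++ applyUpTo (λ x → f (k + x)) (downs w)
    ≡⟨ cong₂ _++_ (applyUpTo-const k (leftTurnAtDowns-D^-< k (true ∷ w)))
                  (applyUpTo-cong (downs w) (leftTurnAtDowns-D^-+ k (true ∷ w))) ⟩
  D^ k ++ swWord (false ∷ true ∷ w)              ∎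
  where
  open ≡-Reasoning
  f : ℕ → Bool
  f = leftTurnAtDowns false (D^ k ++ true ∷ w)

swWord-D-U-last : ∀ w → downs w ≡ 0 → swWord (false ∷ true ∷ w) ≡ []
swWord-D-U-last w e = cong (applyUpTo _) e

swWord-D-U : ∀ w {m} → downs w ≡ suc m → swWord (false ∷ true ∷ w) ≡ true ∷ swWord w
swWord-D-U w e rewrite e = refl

-- Reconstructing a path from its arrow sequences

-- decode reads s after each up-step (the first one virtual): a blank means the
-- next step goes up, an arrow starts a down-run. The run takes one down-step per
-- blank of t up to the next arrow and one for that arrow, then an up-step; if t
-- has no arrow left, the run ends the path's down-steps and the rest of s
-- consists of blanks. Once s is used up, the remaining down-steps follow.
mutual
  decode : List Bool → List Bool → List Bool
  decode []          t = D^ suc (length t)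
  decode (false ∷ s) t = true ∷ decode s t
  decode (true ∷ s)  t = decodeRun s t

  decodeRun : List Bool → List Bool → List Bool
  decodeRun s []          = false ∷ true ∷ U^ (length s)
  decodeRun s (true ∷ t)  = false ∷ true ∷ decode s t
  decodeRun s (false ∷ t) = false ∷ decodeRun s t

decodeRun-D^ : ∀ s m t → decodeRun s (D^ m ++ t) ≡ D^ m ++ decodeRun s t
decodeRun-D^ s zero    t = refl
decodeRun-D^ s (suc m) t = cong (false ∷_) (decodeRun-D^ s m t)

decode-nwWord-swWord : ∀ {W} → Blocks W → 1 ≤ downs W → decode (nwWord W) (swWord W) ≡ W
decode-nwWord-swWord (downsOnly (suc k)) _ = begin
  decode (nwWord (D^ suc k)) (swWord (D^ suc k)) ≡⟨ cong₂ decode (nwWord-D^ (suc k)) (swWord-D^ (suc k)) ⟩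
  D^ suc (length (D^ k))                         ≡⟨ cong (D^_ ∘ suc) (List.length-replicate k) ⟩
  D^ suc k                                       ∎
  where open ≡-Reasoning
decode-nwWord-swWord (downsThenUp zero b) 1≤downs = cong (true ∷_) (decode-nwWord-swWord b 1≤downs)
decode-nwWord-swWord (downsThenUp (suc k) {w} b) _ with downs w in eq
... | zero = begin
  decode (nwWord W) (swWord W)                          ≡⟨ cong₂ decode (nwWord-D^-U k w) (swWord-D^-U k w) ⟩
  decodeRun (nwWord w) (D^ k ++ swWord (false ∷ true ∷ w))
    ≡⟨ cong (decodeRun (nwWord w) ∘ (D^ k ++_)) (swWord-D-U-last w eq) ⟩
  decodeRun (nwWord w) (D^ k ++ [])                     ≡⟨ decodeRun-D^ (nwWord w) k [] ⟩
  D^ k ++ false ∷ true ∷ U^ (length (nwWord w))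
    ≡⟨ cong (λ j → D^ k ++ false ∷ true ∷ U^ j) (List.length-applyUpTo _ (ups w)) ⟩
  D^ k ++ false ∷ true ∷ U^ (ups w)                     ≡⟨ cong (λ v → D^ k ++ false ∷ true ∷ v) (U^-ups w eq) ⟩
  D^ k ++ false ∷ true ∷ w                              ≡⟨ D^-shift k (true ∷ w) ⟩
  W                                                     ∎
  where
  open ≡-Reasoning
  W : List Bool
  W = D^ suc k ++ true ∷ w
... | suc m = begin
  decode (nwWord W) (swWord W)                          ≡⟨ cong₂ decode (nwWord-D^-U k w) (swWord-D^-U k w) ⟩
  decodeRun (nwWord w) (D^ k ++ swWord (false ∷ true ∷ w))
    ≡⟨ cong (decodeRun (nwWord w) ∘ (D^ k ++_)) (swWord-D-U w eq) ⟩
  decodeRun (nwWord w) (D^ k ++ true ∷ swWord w)        ≡⟨ decodeRun-D^ (nwWord w) k (true ∷ swWord w) ⟩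
  D^ k ++ false ∷ true ∷ decode (nwWord w) (swWord w)
    ≡⟨ cong (λ v → D^ k ++ false ∷ true ∷ v) (decode-nwWord-swWord b (subst (1 ≤_) (sym eq) (s≤s z≤n))) ⟩
  D^ k ++ false ∷ true ∷ w                              ≡⟨ D^-shift k (true ∷ w) ⟩
  W                                                     ∎
  where
  open ≡-Reasoning
  W : List Bool
  W = D^ suc k ++ true ∷ w

Checkmark : ℕ → ℕ → Set
Checkmark a b = (a ≡ b) ⊎ (a ≡ suc b)

Checkmark-suc : ∀ {a b} → Checkmark a b → Checkmark (suc a) (suc b)
Checkmark-suc (inj₁ a≡b)   = inj₁ (cong suc a≡b)
Checkmark-suc (inj₂ a≡1+b) = inj₂ (cong suc a≡1+b)

Checkmark-pred : ∀ {a b} → Checkmark (suc a) (suc b) → Checkmark a b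
Checkmark-pred (inj₁ e) = inj₁ (ℕ.suc-injective e)
Checkmark-pred (inj₂ e) = inj₂ (ℕ.suc-injective e)

Checkmark-suc-zero : ∀ {a} → Checkmark (suc a) 0 → a ≡ 0
Checkmark-suc-zero (inj₂ e) = ℕ.suc-injective e
Checkmark-suc-zero (inj₁ ())

ups-nwWord-noDowns : ∀ w → downs w ≡ 0 → ups (nwWord w) ≡ 0
ups-nwWord-noDowns w eq = begin
  ups (nwWord w)          ≡⟨ cong (ups ∘ nwWord) (U^-ups w eq) ⟨
  ups (nwWord (U^ ups w)) ≡⟨ cong ups (nwWord-U^ (ups w)) ⟩
  ups (D^ ups w)          ≡⟨ ups-D^ (ups w) ⟩
  0                       ∎
  where open ≡-Reasoning

ups-swWord-D^-U-last : ∀ k w → downs w ≡ 0 → ups (swWord (D^ suc k ++ true ∷ w)) ≡ 0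
ups-swWord-D^-U-last k w eq = begin
  ups (swWord (D^ suc k ++ true ∷ w))       ≡⟨ cong ups (swWord-D^-U k w) ⟩
  ups (D^ k ++ swWord (false ∷ true ∷ w))  ≡⟨ ups-D^++ k _ ⟩
  ups (swWord (false ∷ true ∷ w))           ≡⟨ cong ups (swWord-D-U-last w eq) ⟩
  0                                         ∎
  where open ≡-Reasoning

ups-swWord-D^-U : ∀ k w {m} → downs w ≡ suc m → ups (swWord (D^ suc k ++ true ∷ w)) ≡ suc (ups (swWord w))
ups-swWord-D^-U k w eq = begin
  ups (swWord (D^ suc k ++ true ∷ w))       ≡⟨ cong ups (swWord-D^-U k w) ⟩
  ups (D^ k ++ swWord (false ∷ true ∷ w))  ≡⟨ ups-D^++ k _ ⟩
  ups (swWord (false ∷ true ∷ w))           ≡⟨ cong ups (swWord-D-U w eq) ⟩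
  suc (ups (swWord w))                      ∎
  where open ≡-Reasoning

nwWord-swWord-checkmark : ∀ {W} → Blocks W → Checkmark (ups (nwWord W)) (ups (swWord W))
nwWord-swWord-checkmark (downsOnly k) = inj₁ (trans (cong ups (nwWord-D^ k)) (sym (trans (cong ups (swWord-D^ k)) (ups-D^ (k ∸ 1)))))
nwWord-swWord-checkmark (downsThenUp zero b) = nwWord-swWord-checkmark b
nwWord-swWord-checkmark (downsThenUp (suc k) {w} b) with downs w in eq
... | zero  = inj₂ (trans (cong ups (nwWord-D^-U k w))
                          (cong suc (trans (ups-nwWord-noDowns w eq) (sym (ups-swWord-D^-U-last k w eq)))))
... | suc m = subst₂ Checkmark (sym (cong ups (nwWord-D^-U k w))) (sym (ups-swWord-D^-U k w eq))
                     (Checkmark-suc (nwWord-swWord-checkmark b))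

Represents : List Bool → List Bool → List Bool → Set
Represents s t W = downs W ≡ suc (length t) × nwWord W ≡ s × swWord W ≡ t

Represents-U : ∀ {s t W} → Represents s t W → Represents (false ∷ s) t (true ∷ W)
Represents-U (downs≡ , nw≡ , sw≡) = downs≡ , cong (false ∷_) nw≡ , sw≡

Represents-D^-U : ∀ {s t W} m → Represents s t W → Represents (true ∷ s) (D^ m ++ true ∷ t) (D^ suc m ++ true ∷ W)
Represents-D^-U {s} {t} {W} m (downs≡ , nw≡ , sw≡) = downs≡′ , nw≡′ , sw≡′
  where
  open ≡-Reasoning
  downs≡′ : downs (D^ suc m ++ true ∷ W) ≡ suc (length (D^ m ++ true ∷ t))
  downs≡′ = begin
    downs (D^ suc m ++ true ∷ W)   ≡⟨ downs-D^++ (suc m) (true ∷ W) ⟩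
    suc m + downs W                ≡⟨ cong (suc m ℕ.+_) downs≡ ⟩
    suc (m + suc (length t))       ≡⟨ cong (λ k → suc (k + suc (length t))) (List.length-replicate m) ⟨
    suc (length (D^ m) + length (true ∷ t)) ≡⟨ cong suc (List.length-++ (D^ m)) ⟨
    suc (length (D^ m ++ true ∷ t)) ∎
  nw≡′ : nwWord (D^ suc m ++ true ∷ W) ≡ true ∷ s
  nw≡′ = trans (nwWord-D^-U m W) (cong (true ∷_) nw≡)
  sw≡′ : swWord (D^ suc m ++ true ∷ W) ≡ D^ m ++ true ∷ t
  sw≡′ = begin
    swWord (D^ suc m ++ true ∷ W)        ≡⟨ swWord-D^-U m W ⟩
    D^ m ++ swWord (false ∷ true ∷ W)   ≡⟨ cong (D^ m ++_) (swWord-D-U W downs≡) ⟩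
    D^ m ++ true ∷ swWord W              ≡⟨ cong (λ v → D^ m ++ true ∷ v) sw≡ ⟩
    D^ m ++ true ∷ t                     ∎

Represents-D^-U-last : ∀ m j → Represents (true ∷ D^ j) (D^ m) (D^ suc m ++ true ∷ U^ j)
Represents-D^-U-last m j = downs≡ , nw≡ , sw≡
  where
  open ≡-Reasoning
  downs≡ : downs (D^ suc m ++ true ∷ U^ j) ≡ suc (length (D^ m))
  downs≡ = begin
    downs (D^ suc m ++ true ∷ U^ j) ≡⟨ downs-D^++ (suc m) (true ∷ U^ j) ⟩
    suc m + downs (U^ j)            ≡⟨ cong (suc m ℕ.+_) (downs-U^ j) ⟩
    suc m + 0                       ≡⟨ cong suc (ℕ.+-identityʳ m) ⟩
    suc m                           ≡⟨ cong suc (List.length-replicate m) ⟨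
    suc (length (D^ m))             ∎
  nw≡ : nwWord (D^ suc m ++ true ∷ U^ j) ≡ true ∷ D^ j
  nw≡ = trans (nwWord-D^-U m (U^ j)) (cong (true ∷_) (nwWord-U^ j))
  sw≡ : swWord (D^ suc m ++ true ∷ U^ j) ≡ D^ m
  sw≡ = begin
    swWord (D^ suc m ++ true ∷ U^ j)       ≡⟨ swWord-D^-U m (U^ j) ⟩
    D^ m ++ swWord (false ∷ true ∷ U^ j)  ≡⟨ cong (D^ m ++_) (swWord-D-U-last (U^ j) (downs-U^ j)) ⟩
    D^ m ++ []                             ≡⟨ List.++-identityʳ (D^ m) ⟩
    D^ m                                   ∎

decode-represents : ∀ s t → Checkmark (ups s) (ups t) → Represents s t (decode s t)
decode-represents []          t (inj₂ ())
decode-represents []          t (inj₁ 0≡ups) =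
  downs-D^ (suc (length t)) , nwWord-D^ (suc (length t)) , trans (swWord-D^ (suc (length t))) (D^-length t (sym 0≡ups))
decode-represents (false ∷ s) t ck = Represents-U {W = decode s t} (decode-represents s t ck)
decode-represents (true ∷ s)  t ck with blocks t
... | downsThenUp m {t′} _ =
  subst (Represents (true ∷ s) (D^ m ++ true ∷ t′)) (sym decoded)
        (Represents-D^-U m (decode-represents s t′ (Checkmark-pred (subst (Checkmark _) (ups-D^++ m (true ∷ t′)) ck))))
  where
  decoded : decodeRun s (D^ m ++ true ∷ t′) ≡ D^ suc m ++ true ∷ decode s t′
  decoded = trans (decodeRun-D^ s m (true ∷ t′)) (D^-shift m (true ∷ decode s t′))
... | downsOnly m = subst₂ (λ s′ W → Represents (true ∷ s′) (D^ m) W) (D^-length s (Checkmark-suc-zero (subst (Checkmark _) (ups-D^ m) ck))) (sym decoded)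
                          (Represents-D^-U-last m (length s))
  where
  decoded : decodeRun s (D^ m) ≡ D^ suc m ++ true ∷ U^ (length s)
  decoded = begin
    decodeRun s (D^ m)                  ≡⟨ cong (decodeRun s) (List.++-identityʳ (D^ m)) ⟨
    decodeRun s (D^ m ++ [])            ≡⟨ decodeRun-D^ s m [] ⟩
    D^ m ++ false ∷ true ∷ U^ (length s) ≡⟨ D^-shift m (true ∷ U^ (length s)) ⟩
    D^ suc m ++ true ∷ U^ (length s)    ∎
    where open ≡-Reasoning

-- Nonnegativity

-- NonNegative u d W: W, started from a vertex reached by u up-steps and
-- d down-steps, never goes below the axis.
NonNegative : ℕ → ℕ → List Bool → Set
NonNegative u d []          = ⊤
NonNegative u d (true ∷ w)  = NonNegative (suc u) d w
NonNegative u d (false ∷ w) = suc d ≤ u × NonNegative u (suc d) w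

NonNegative-D^ : ∀ {u d} k → d + k ≤ u → NonNegative u d (D^ k)
NonNegative-D^         zero    _     = tt
NonNegative-D^ {u} {d} (suc k) d+k≤u =
  ℕ.≤-trans (ℕ.m≤m+n (suc d) k) 1+d+k≤u , NonNegative-D^ k 1+d+k≤u
  where
  1+d+k≤u : suc d + k ≤ u
  1+d+k≤u = subst (_≤ u) (ℕ.+-suc d k) d+k≤u

NonNegative-D^++ : ∀ {u d} k r →
  NonNegative u d (D^ suc k ++ r) ⇔ (suc k + d ≤ u × NonNegative u (suc k + d) r)
NonNegative-D^++ zero r = mk⇔ (λ nn → nn) (λ nn → nn)
NonNegative-D^++ {u} {d} (suc k) r = mk⇔ to from
  where
  shift : suc k + suc d ≡ suc (suc k) + d
  shift = ℕ.+-suc (suc k) d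
  to : NonNegative u d (D^ suc (suc k) ++ r) → suc (suc k) + d ≤ u × NonNegative u (suc (suc k) + d) r
  to (_ , nn) = let le , nn′ = Equivalence.to (NonNegative-D^++ k r) nn
                in subst (_≤ u) shift le , subst (λ x → NonNegative u x r) shift nn′
  from : suc (suc k) + d ≤ u × NonNegative u (suc (suc k) + d) r → NonNegative u d (D^ suc (suc k) ++ r)
  from (le , nn) = ℕ.≤-trans (s≤s (ℕ.m≤n+m d (suc k))) le ,
    Equivalence.from (NonNegative-D^++ k r) (subst (_≤ u) (sym shift) le , subst (λ x → NonNegative u x r) (sym shift) nn)

Dominates : List ℕ → List ℕ → Set
Dominates A B = ∀ h a → nth A h ≡ just a → Σ ℕ λ b → (nth B h ≡ just b) × (b < a)

Dominates-[] : ∀ B → Dominates [] B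
Dominates-[] B h a ()

¬Dominates-∷-[] : ∀ a A → ¬ Dominates (a ∷ A) []
¬Dominates-∷-[] a A dom with dom 0 a refl
... | _ , () , _

Dominates-∷ : ∀ a A b B → Dominates (a ∷ A) (b ∷ B) ⇔ (b < a × Dominates A B)
Dominates-∷ a A b B = mk⇔ to from
  where
  to : Dominates (a ∷ A) (b ∷ B) → b < a × Dominates A B
  to dom with dom 0 a refl
  ... | _ , refl , b<a = b<a , λ h → dom (suc h)
  from : b < a × Dominates A B → Dominates (a ∷ A) (b ∷ B)
  from (b<a , dom) zero    _ refl = b , refl , b<a
  from (b<a , dom) (suc h) a′ eq  = dom h a′ eq

arrowPosFrom-D^ : ∀ d m l → arrowPosFrom (suc d) (D^ m ++ l) ≡ arrowPosFrom (suc m + d) l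
arrowPosFrom-D^ d zero    l = refl
arrowPosFrom-D^ d (suc m) l = trans (arrowPosFrom-D^ (suc d) m l) (cong (λ i → arrowPosFrom (suc i) l) (ℕ.+-suc m d))

balance-D^-U : ∀ {u d} k w → d + downs (D^ suc k ++ true ∷ w) ≡ u + ups (D^ suc k ++ true ∷ w) →
  suc k + d + downs w ≡ suc u + ups w
balance-D^-U {u} {d} k w balanced = begin
  suc k + d + downs w                ≡⟨ cong (_+ downs w) (ℕ.+-comm (suc k) d) ⟩
  d + suc k + downs w                ≡⟨ ℕ.+-assoc d (suc k) (downs w) ⟩
  d + (suc k + downs w)              ≡⟨ cong (d ℕ.+_) (downs-D^++ (suc k) (true ∷ w)) ⟨
  d + downs (D^ suc k ++ true ∷ w)  ≡⟨ balanced ⟩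
  u + ups (D^ suc k ++ true ∷ w)    ≡⟨ cong (u ℕ.+_) (ups-D^++ (suc k) (true ∷ w)) ⟩
  u + suc (ups w)                    ≡⟨ ℕ.+-suc u (ups w) ⟩
  suc u + ups w                      ∎
  where open ≡-Reasoning

arrowPosFrom-nwWord-D^-U : ∀ u k w →
  arrowPosFrom (suc u) (nwWord (D^ suc k ++ true ∷ w)) ≡ suc u ∷ arrowPosFrom (suc (suc u)) (nwWord w)
arrowPosFrom-nwWord-D^-U u k w = cong (arrowPosFrom (suc u)) (nwWord-D^-U k w)

arrowPosFrom-swWord-D^-U-last : ∀ d k w → downs w ≡ 0 → arrowPosFrom (suc d) (swWord (D^ suc k ++ true ∷ w)) ≡ []
arrowPosFrom-swWord-D^-U-last d k w eq = begin
  arrowPosFrom (suc d) (swWord (D^ suc k ++ true ∷ w))       ≡⟨ cong (arrowPosFrom (suc d)) (swWord-D^-U k w) ⟩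
  arrowPosFrom (suc d) (D^ k ++ swWord (false ∷ true ∷ w))  ≡⟨ cong (arrowPosFrom (suc d) ∘ (D^ k ++_)) (swWord-D-U-last w eq) ⟩
  arrowPosFrom (suc d) (D^ k ++ [])                          ≡⟨ arrowPosFrom-D^ d k [] ⟩
  []                                                         ∎
  where open ≡-Reasoning

arrowPosFrom-swWord-D^-U : ∀ d k w {m} → downs w ≡ suc m →
  arrowPosFrom (suc d) (swWord (D^ suc k ++ true ∷ w)) ≡ suc k + d ∷ arrowPosFrom (suc (suc k + d)) (swWord w)
arrowPosFrom-swWord-D^-U d k w eq = begin
  arrowPosFrom (suc d) (swWord (D^ suc k ++ true ∷ w))       ≡⟨ cong (arrowPosFrom (suc d)) (swWord-D^-U k w) ⟩
  arrowPosFrom (suc d) (D^ k ++ swWord (false ∷ true ∷ w))  ≡⟨ cong (arrowPosFrom (suc d) ∘ (D^ k ++_)) (swWord-D-U w eq) ⟩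
  arrowPosFrom (suc d) (D^ k ++ true ∷ swWord w)             ≡⟨ arrowPosFrom-D^ d k (true ∷ swWord w) ⟩
  suc k + d ∷ arrowPosFrom (suc (suc k + d)) (swWord w)      ∎
  where open ≡-Reasoning

-- As w has no down-steps, the path climbs back to the axis after the run D^ suc k,
-- so that run ends below the axis.
¬NonNegative-D^-U-last : ∀ {u d} k w → downs w ≡ 0 →
  d + downs (D^ suc k ++ true ∷ w) ≡ u + ups (D^ suc k ++ true ∷ w) → ¬ NonNegative u d (D^ suc k ++ true ∷ w)
¬NonNegative-D^-U-last {u} {d} k w eq balanced nn =
  ℕ.n≮n u (ℕ.≤-trans (ℕ.m≤m+n (suc u) (ups w)) (subst (_≤ u) endpoint 1+k+d≤u))
  where
  1+k+d≤u : suc k + d ≤ u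
  1+k+d≤u = proj₁ (Equivalence.to (NonNegative-D^++ k (true ∷ w)) nn)
  endpoint : suc k + d ≡ suc u + ups w
  endpoint = trans (sym (ℕ.+-identityʳ (suc k + d))) (trans (cong (suc k + d ℕ.+_) (sym eq)) (balance-D^-U k w balanced))

-- Counting from the vertex reached by u up- and d down-steps, the h-th nonempty
-- down-run of W follows a − 1 up-steps and ends after b down-steps, where a and
-- b are the h-th arrow positions of nwWord W and swWord W. These run ends are the
-- local minima of W, so b < a for every h says exactly that W stays above the axis.
nonNegative⇔dominates : ∀ {W} → Blocks W → ∀ u d → d + downs W ≡ u + ups W →
  NonNegative u d W ⇔ Dominates (arrowPosFrom (suc u) (nwWord W)) (arrowPosFrom (suc d) (swWord W))
nonNegative⇔dominates (downsOnly k) u d balanced =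
  mk⇔ (λ _ → subst (λ s → Dominates (arrowPosFrom (suc u) s) B) (sym (nwWord-D^ k)) (Dominates-[] B))
      (λ _ → NonNegative-D^ k (ℕ.≤-reflexive d+k≡u))
  where
  open ≡-Reasoning
  B : List ℕ
  B = arrowPosFrom (suc d) (swWord (D^ k))
  d+k≡u : d + k ≡ u
  d+k≡u = begin
    d + k             ≡⟨ cong (d ℕ.+_) (downs-D^ k) ⟨
    d + downs (D^ k)  ≡⟨ balanced ⟩
    u + ups (D^ k)    ≡⟨ cong (u ℕ.+_) (ups-D^ k) ⟩
    u + 0             ≡⟨ ℕ.+-identityʳ u ⟩
    u                 ∎
nonNegative⇔dominates (downsThenUp zero {w} b) u d balanced =
  nonNegative⇔dominates b (suc u) d (trans balanced (ℕ.+-suc u (ups w)))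
nonNegative⇔dominates (downsThenUp (suc k) {w} b) u d balanced with downs w in eq
... | zero  = mk⇔ (⊥-elim ∘ ¬NonNegative-D^-U-last k w eq balanced)
  (⊥-elim ∘ ¬Dominates-∷-[] _ _ ∘ subst₂ Dominates (arrowPosFrom-nwWord-D^-U u k w) (arrowPosFrom-swWord-D^-U-last d k w eq))
... | suc m = subst₂ (λ A B → NonNegative u d (D^ suc k ++ true ∷ w) ⇔ Dominates A B)
  (sym (arrowPosFrom-nwWord-D^-U u k w)) (sym (arrowPosFrom-swWord-D^-U d k w eq))
  (⇔-trans (NonNegative-D^++ k (true ∷ w))
  (⇔-trans (mk⇔ s≤s ℕ.s≤s⁻¹ ×-⇔ nonNegative⇔dominates b (suc u) (suc k + d) (balance-D^-U k w balanced))
           (⇔-sym (Dominates-∷ _ _ _ _))))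

nonNegative⇒ : ∀ {u d} l → d ≤ u → NonNegative u d l → ∀ i → d + downs (take i l) ≤ u + ups (take i l)
nonNegative⇒ {u} {d} l           d≤u nn zero    = ℕ.+-mono-≤ d≤u z≤n
nonNegative⇒ {u} {d} []          d≤u nn (suc i) = ℕ.+-mono-≤ d≤u z≤n
nonNegative⇒ {u} {d} (true ∷ l)  d≤u nn (suc i) =
  subst (d + downs (take i l) ≤_) (sym (ℕ.+-suc u (ups (take i l)))) (nonNegative⇒ l (ℕ.m≤n⇒m≤1+n d≤u) nn i)
nonNegative⇒ {u} {d} (false ∷ l) d≤u (d<u , nn) (suc i) =
  subst (_≤ u + ups (take i l)) (sym (ℕ.+-suc d (downs (take i l)))) (nonNegative⇒ l d<u nn i)

nonNegative⇐ : ∀ {u d} l → (∀ i → i ≤ length l → d + downs (take i l) ≤ u + ups (take i l)) → NonNegative u d l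
nonNegative⇐ []                  above = tt
nonNegative⇐ {u} {d} (true ∷ l)  above = nonNegative⇐ l λ i i≤len →
  subst (d + downs (take i l) ≤_) (ℕ.+-suc u (ups (take i l))) (above (suc i) (s≤s i≤len))
nonNegative⇐ {u} {d} (false ∷ l) above =
  subst₂ _≤_ (ℕ.+-comm d 1) (ℕ.+-identityʳ u) (above 1 (s≤s z≤n)) ,
  nonNegative⇐ l λ i i≤len → subst (_≤ u + ups (take i l)) (ℕ.+-suc d (downs (take i l))) (above (suc i) (s≤s i≤len))

height≥0⇔ : ∀ l i → + 0 ℤ.≤ height l i ⇔ downs (take i l) ≤ ups (take i l)
height≥0⇔ l i = mk⇔
  (λ 0≤h → ℤ.drop‿+≤+ (ℤ.0≤i-j⇒j≤i (subst (+ 0 ℤ.≤_) (height≡ups-downs l i) 0≤h)))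
  (λ d≤u → subst (+ 0 ℤ.≤_) (sym (height≡ups-downs l i)) (ℤ.i≤j⇒0≤j-i (+≤+ d≤u)))

nonNegative⇔height≥0 : ∀ l → NonNegative 0 0 l ⇔ (∀ i → i ≤ length l → + 0 ℤ.≤ height l i)
nonNegative⇔height≥0 l = mk⇔
  (λ nn i _ → Equivalence.from (height≥0⇔ l i) (nonNegative⇒ l z≤n nn i))
  (λ h≥0 → nonNegative⇐ l λ i i≤len → Equivalence.to (height≥0⇔ l i) (h≥0 i i≤len))

toList-injective : ∀ {A : Set} {m} (u v : Vec A m) → toList u ≡ toList v → u ≡ v
toList-injective u v e = trans (sym (Vec.cast-is-id refl u)) (Vec.toList-injective refl u v e)

toList-tabulate : ∀ {A : Set} n (f : ℕ → A) → toList (tabulate {n = n} (f ∘ toℕ)) ≡ applyUpTo f n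
toList-tabulate zero    f = refl
toList-tabulate (suc n) f = cong (f 0 ∷_) (toList-tabulate n (f ∘ suc))

length-arrowPosFrom : ∀ k l → length (arrowPosFrom k l) ≡ ups l
length-arrowPosFrom k []          = refl
length-arrowPosFrom k (true ∷ l)  = cong suc (length-arrowPosFrom (suc k) l)
length-arrowPosFrom k (false ∷ l) = length-arrowPosFrom (suc k) l

arrows≡ups : ∀ {m} (v : Vec Bool m) → arrows v ≡ ups (toList v)
arrows≡ups v = length-arrowPosFrom 1 (toList v)

height-end : ∀ l → height l (length l) ≡ + ups l ℤ.- + downs l
height-end l = trans (height≡ups-downs l (length l)) (cong (λ w → + ups w ℤ.- + downs w) (List.take-all (length l) l ℕ.≤-refl))

returns⇒balanced : ∀ n l → length l ≡ 2 * n → height l (2 * n) ≡ + 0 → ups l ≡ n × downs l ≡ n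
returns⇒balanced n l len≡2n returns = ups≡n , trans (sym ups≡downs) ups≡n
  where
  open ≡-Reasoning
  ups≡downs : ups l ≡ downs l
  ups≡downs = ℤ.+-injective (ℤ.i-j≡0⇒i≡j _ _ (trans (sym (height-end l)) (trans (cong (height l) len≡2n) returns)))
  ups≡n : ups l ≡ n
  ups≡n = ℕ.*-cancelˡ-≡ (ups l) n 2 (begin
    2 * ups l            ≡⟨ cong (ups l ℕ.+_) (ℕ.+-identityʳ (ups l)) ⟩
    ups l + ups l        ≡⟨ cong (ups l ℕ.+_) ups≡downs ⟩
    ups l + downs l      ≡⟨ ups+downs≡length l ⟩
    length l             ≡⟨ len≡2n ⟩
    2 * n                ∎)

balanced⇒returns : ∀ n l → ups l ≡ n → downs l ≡ n → height l (length l) ≡ + 0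
balanced⇒returns n l ups≡n downs≡n =
  trans (height-end l) (trans (cong₂ (λ a b → + a ℤ.- + b) ups≡n downs≡n) (ℤ.+-inverseʳ (+ n)))

toList-sNW : ∀ n (p : Path n) → toList (sNW n p) ≡ applyUpTo (rightTurnAtUps true (toList p)) n
toList-sNW n p = trans (toList-tabulate n _)
  (applyUpTo-cong n λ h → rightTurn-entry (toList p) (2 * n) h (ℕ.≤-reflexive (Vec.length-toList p)))

toList-sSW : ∀ n (p : Path n) → toList (sSW n p) ≡ applyUpTo (leftTurnAtDowns true (toList p) ∘ suc) (n ∸ 1)
toList-sSW n p = trans (toList-tabulate (n ∸ 1) _)
  (applyUpTo-cong (n ∸ 1) λ j → leftTurn-entry (toList p) (2 * n) (suc j) (ℕ.≤-reflexive (Vec.length-toList p)))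

bilateral⇒balanced : ∀ n (p : Path n) → IsBilateral n p → ups (toList p) ≡ n × downs (toList p) ≡ n
bilateral⇒balanced n p = returns⇒balanced n (toList p) (Vec.length-toList p)

sNW≡nwWord : ∀ n (p : Path n) → IsBilateral n p → toList (sNW n p) ≡ nwWord (toList p)
sNW≡nwWord n p bilateral =
  trans (toList-sNW n p) (cong (applyUpTo (rightTurnAtUps true (toList p))) (sym (proj₁ (bilateral⇒balanced n p bilateral))))

sSW≡swWord : ∀ n (p : Path n) → IsBilateral n p → toList (sSW n p) ≡ swWord (toList p)
sSW≡swWord n p bilateral =
  trans (toList-sSW n p) (cong (λ m → applyUpTo (leftTurnAtDowns true (toList p) ∘ suc) (m ∸ 1)) (sym (proj₂ (bilateral⇒balanced n p bilateral))))

checkmark-of-bilateral : ∀ n (p : Path n) → IsBilateral n p → IsCheckmarkPair n (sNW n p) (sSW n p)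
checkmark-of-bilateral n p bilateral = subst₂ Checkmark
  (sym (trans (arrows≡ups (sNW n p)) (cong ups (sNW≡nwWord n p bilateral))))
  (sym (trans (arrows≡ups (sSW n p)) (cong ups (sSW≡swWord n p bilateral))))
  (nwWord-swWord-checkmark (blocks (toList p)))

decode-sNW-sSW : ∀ n (p : Path (suc n)) → IsBilateral (suc n) p → decode (toList (sNW (suc n) p)) (toList (sSW (suc n) p)) ≡ toList p
decode-sNW-sSW n p bilateral = begin
  decode (toList (sNW (suc n) p)) (toList (sSW (suc n) p)) ≡⟨ cong₂ decode (sNW≡nwWord (suc n) p bilateral) (sSW≡swWord (suc n) p bilateral) ⟩
  decode (nwWord (toList p)) (swWord (toList p))         ≡⟨ decode-nwWord-swWord (blocks (toList p)) 1≤downs ⟩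
  toList p                                               ∎
  where
  open ≡-Reasoning
  1≤downs : 1 ≤ downs (toList p)
  1≤downs = subst (1 ≤_) (sym (proj₂ (bilateral⇒balanced (suc n) p bilateral))) (s≤s z≤n)

checkmark-injective : ∀ n (p q : Path (suc n)) → IsBilateral (suc n) p → IsBilateral (suc n) q →
  sNW (suc n) p ≡ sNW (suc n) q → sSW (suc n) p ≡ sSW (suc n) q → p ≡ q
checkmark-injective n p q bilateral-p bilateral-q sNW≡ sSW≡ = toList-injective p q (begin
  toList p                                                  ≡⟨ decode-sNW-sSW n p bilateral-p ⟨
  decode (toList (sNW (suc n) p)) (toList (sSW (suc n) p))  ≡⟨ cong₂ decode (cong toList sNW≡) (cong toList sSW≡) ⟩
  decode (toList (sNW (suc n) q)) (toList (sSW (suc n) q))  ≡⟨ decode-sNW-sSW n q bilateral-q ⟩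
  toList q                                                  ∎)
  where open ≡-Reasoning

balanced-path : ∀ n W → ups W ≡ n → downs W ≡ n → Σ (Path n) λ p → IsBilateral n p × toList p ≡ W
balanced-path n W ups≡n downs≡n = p , bilateral , toList-p
  where
  length≡ : length W ≡ 2 * n
  length≡ = trans (sym (ups+downs≡length W)) (trans (cong₂ _+_ ups≡n downs≡n) (cong (n ℕ.+_) (sym (ℕ.+-identityʳ n))))
  p : Path n
  p = cast length≡ (fromList W)
  toList-p : toList p ≡ W
  toList-p = trans (Vec.toList-cast length≡ (fromList W)) (Vec.toList∘fromList W)
  bilateral : IsBilateral n p
  bilateral = subst₂ (λ l m → height l m ≡ + 0) (sym toList-p) length≡ (balanced⇒returns n W ups≡n downs≡n)

checkmark-surjective : ∀ n (s : Vec Bool (suc n)) (t : Vec Bool n) → IsCheckmarkPair (suc n) s t →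
  Σ (Path (suc n)) λ p → IsBilateral (suc n) p × (sNW (suc n) p ≡ s) × (sSW (suc n) p ≡ t)
checkmark-surjective n s t checkmark = p , bilateral ,
  toList-injective (sNW (suc n) p) s (trans (sNW≡nwWord (suc n) p bilateral) (trans (cong nwWord toList-p) nwWord≡s)) ,
  toList-injective (sSW (suc n) p) t (trans (sSW≡swWord (suc n) p bilateral) (trans (cong swWord toList-p) swWord≡t))
  where
  W : List Bool
  W = decode (toList s) (toList t)
  represents : Represents (toList s) (toList t) W
  represents = decode-represents (toList s) (toList t) (subst₂ Checkmark (arrows≡ups s) (arrows≡ups t) checkmark)
  nwWord≡s : nwWord W ≡ toList s
  nwWord≡s = proj₁ (proj₂ represents)
  swWord≡t : swWord W ≡ toList t
  swWord≡t = proj₂ (proj₂ represents)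
  downs≡ : downs W ≡ suc n
  downs≡ = trans (proj₁ represents) (cong suc (Vec.length-toList t))
  ups≡ : ups W ≡ suc n
  ups≡ = trans (sym (List.length-applyUpTo _ (ups W))) (trans (cong length nwWord≡s) (Vec.length-toList s))
  path : Σ (Path (suc n)) λ p → IsBilateral (suc n) p × toList p ≡ W
  path = balanced-path (suc n) W ups≡ downs≡
  p : Path (suc n)
  p = proj₁ path
  bilateral : IsBilateral (suc n) p
  bilateral = proj₁ (proj₂ path)
  toList-p : toList p ≡ W
  toList-p = proj₂ (proj₂ path)

dyck⇔dominates : ∀ n (p : Path n) → IsBilateral n p →
  (∀ i → i ≤ 2 * n → + 0 ℤ.≤ height (toList p) i) ⇔ Dominates (arrowPos (sNW n p)) (arrowPos (sSW n p))
dyck⇔dominates n p bilateral =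
  ⇔-trans heights (⇔-trans (⇔-sym (nonNegative⇔height≥0 l))
  (⇔-trans (nonNegative⇔dominates (blocks l) 0 0 (trans (proj₂ ups≡n,downs≡n) (sym (proj₁ ups≡n,downs≡n)))) positions))
  where
  l : List Bool
  l = toList p
  ups≡n,downs≡n : ups l ≡ n × downs l ≡ n
  ups≡n,downs≡n = bilateral⇒balanced n p bilateral
  heights : (∀ i → i ≤ 2 * n → + 0 ℤ.≤ height l i) ⇔ (∀ i → i ≤ length l → + 0 ℤ.≤ height l i)
  heights = subst (λ m → (∀ i → i ≤ 2 * n → + 0 ℤ.≤ height l i) ⇔ (∀ i → i ≤ m → + 0 ℤ.≤ height l i))
                  (sym (Vec.length-toList p)) ⇔-refl
  positions : Dominates (arrowPosFrom 1 (nwWord l)) (arrowPosFrom 1 (swWord l)) ⇔ Dominates (arrowPos (sNW n p)) (arrowPos (sSW n p))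
  positions = subst₂ (λ A B → Dominates (arrowPosFrom 1 (nwWord l)) (arrowPosFrom 1 (swWord l)) ⇔ Dominates A B)
                     (cong (arrowPosFrom 1) (sym (sNW≡nwWord n p bilateral)))
                     (cong (arrowPosFrom 1) (sym (sSW≡swWord n p bilateral))) ⇔-refl

dyckCheckmark-of-dyck : ∀ n (p : Path n) → IsDyck n p → IsDyckCheckmarkPair n (sNW n p) (sSW n p)
dyckCheckmark-of-dyck n p (bilateral , above) =
  checkmark-of-bilateral n p bilateral , Equivalence.to (dyck⇔dominates n p bilateral) above

dyckCheckmark-surjective : ∀ n (s : Vec Bool (suc n)) (t : Vec Bool n) → IsDyckCheckmarkPair (suc n) s t →
  Σ (Path (suc n)) λ p → IsDyck (suc n) p × (sNW (suc n) p ≡ s) × (sSW (suc n) p ≡ t)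
dyckCheckmark-surjective n s t (checkmark , dominates) = p , (bilateral , above) , sNW≡s , sSW≡t
  where
  path : Σ (Path (suc n)) λ p → IsBilateral (suc n) p × (sNW (suc n) p ≡ s) × (sSW (suc n) p ≡ t)
  path = checkmark-surjective n s t checkmark
  p : Path (suc n)
  p = proj₁ path
  bilateral : IsBilateral (suc n) p
  bilateral = proj₁ (proj₂ path)
  sNW≡s : sNW (suc n) p ≡ s
  sNW≡s = proj₁ (proj₂ (proj₂ path))
  sSW≡t : sSW (suc n) p ≡ t
  sSW≡t = proj₂ (proj₂ (proj₂ path))
  above : ∀ i → i ≤ 2 * suc n → + 0 ℤ.≤ height (toList p) i
  above = Equivalence.from (dyck⇔dominates (suc n) p bilateral)
    (subst₂ (λ s′ t′ → Dominates (arrowPos s′) (arrowPos t′)) (sym sNW≡s) (sym sSW≡t) dominates)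

proposition1 : (n : ℕ) → 1 ≤ n →
  ((p : Path n) → IsBilateral n p → IsCheckmarkPair n (sNW n p) (sSW n p))
  × ((p q : Path n) → IsBilateral n p → IsBilateral n q →
       sNW n p ≡ sNW n q → sSW n p ≡ sSW n q → p ≡ q)
  × ((s : Vec Bool n) (t : Vec Bool (n ∸ 1)) → IsCheckmarkPair n s t →
       Σ (Path n) λ p → IsBilateral n p × (sNW n p ≡ s) × (sSW n p ≡ t))
  × ((p : Path n) → IsDyck n p → IsDyckCheckmarkPair n (sNW n p) (sSW n p))
  × ((s : Vec Bool n) (t : Vec Bool (n ∸ 1)) → IsDyckCheckmarkPair n s t →
       Σ (Path n) λ p → IsDyck n p × (sNW n p ≡ s) × (sSW n p ≡ t))
proposition1 (suc n) _ =
  checkmark-of-bilateral (suc n) ,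
  checkmark-injective n ,
  checkmark-surjective n ,
  dyckCheckmark-of-dyck (suc n) ,
  dyckCheckmark-surjective n
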